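{- There is no strategy for sorting on a deque with incomplete information that succeeds on every permutation that is sortable on a deque. More precisely, there exist two permutations of $\{1,\dots,7\}$, both sortable on a deque with complete information, such that any strategy for the incomplete-information game fails to sort at least one of them.
   Context: Sorting on a deque: a permutation $\pi$ of $\{1,\dots,n\}$ is the input list; allowed operations are moving the first input element to the left or right end of a deque, and moving the left or right end element of the deque to the end of the output; $\pi$ is sortable on a deque (with complete information) if some sequence of operations ends with output $1,2,\dots,n$. In the incomplete-information version (the game "Double-Ended Knuth"), the input is a face-down deck: the player sees only the elements already revealed; the next input element is revealed when it becomes the top of the deck, and the player must then decide what to do with it (send it to the output if it is the next element required, or place it at one end of the deque) before seeing any further input element. A strategy is a rule choosing each operation as a function only of the information revealed so far; it succeeds on $\pi$ if following it on input $\pi$ produces output $1,2,\dots,n$. -}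

module Defs where

open import Data.Nat using (ℕ; zero; suc; _∸_)
open import Data.List using (List; []; _∷_; _∷ʳ_; reverse; take; length; applyUpTo)
open import Data.Maybe using (Maybe; just; nothing)
open import Data.Product using (∃-syntax; _×_)
open import Relation.Binary.PropositionalEquality using (_≡_)

data Op : Set where
  pushL pushR popL popR : Op

-- A configuration: remaining input (head = first element), deque
-- (head = left end), output (in order of production).
record Config : Set where
  constructor cfg
  field
    inp : List ℕ
    dq  : List ℕ
    out : List ℕ
open Config public

step : Op → Config → Maybe Config
step pushL (cfg [] d o) = nothing
step pushL (cfg (x ∷ xs) d o) = just (cfg xs (x ∷ d) o)
step pushR (cfg [] d o) = nothing
step pushR (cfg (x ∷ xs) d o) = just (cfg xs (d ∷ʳ x) o)
step popL (cfg i [] o) = nothing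
step popL (cfg i (x ∷ d) o) = just (cfg i d (o ∷ʳ x))
step popR (cfg i d o) with reverse d
... | [] = nothing
... | x ∷ r = just (cfg i (reverse r) (o ∷ʳ x))

run : List Op → Config → Maybe Config
run [] c = just c
run (op ∷ ops) c with step op c
... | nothing = nothing
... | just c' = run ops c'

start : List ℕ → Config
start π = cfg π [] []

oneTo : ℕ → List ℕ
oneTo n = applyUpTo suc n

DequeSortable : ℕ → List ℕ → Set
DequeSortable n π = ∃[ ops ] ∃[ c ] (run ops (start π) ≡ just c × out c ≡ oneTo n)

-- Information revealed to the player in configuration c when the input is π:
-- the input elements already taken from the deck, followed by the current
-- top of the deck (if any).  (take (#consumed + 1) of π.)
revealed : List ℕ → Config → List ℕ
revealed π c = take (suc (length π ∸ length (inp c))) π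

-- A strategy chooses the next operation from the revealed input elements
-- and the history of operations performed so far (oldest first); this is
-- exactly the information available to the player.
Strategy : Set
Strategy = List ℕ → List Op → Op

play : Strategy → List ℕ → ℕ → List Op → Config → Maybe Config
play s π zero h c = just c
play s π (suc k) h c with step (s (revealed π c) h) c
... | nothing = nothing
... | just c' = play s π k (h ∷ʳ s (revealed π c) h) c'

Succeeds : ℕ → Strategy → List ℕ → Set
Succeeds n s π = ∃[ k ] ∃[ c ] (play s π k [] (start π) ≡ just c × out c ≡ oneTo n)

module Submission where

-- Sortability is witnessed by explicit operation sequences.  The negative
-- part is an adversary argument checked by evaluation.  A strategy sees only
-- the revealed part of the input and its own history, so while the revealed
-- prefixes of π₁ and π₂ agree it performs the same operation in both games.
-- A boolean certificate 'refuted' follows every operation in both games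
-- jointly while the views agree; once they differ it requires one of the two
-- configurations to be dead, as detected by a bounded search 'canComplete'
-- that over-approximates "some continuation outputs 1..n".

open import Defs
open import Data.Bool using (Bool; true; false; T; not; _∧_; _∨_; if_then_else_)
open import Data.Bool.Properties using (T-∧; T-∨)
open import Data.Empty using (⊥; ⊥-elim)
open import Data.List using (List; []; _∷_; _∷ʳ_; reverse)
open import Data.Bool.ListAction using (any; all)
open import Data.List.Properties using (≡-dec; ++-monoid)
open import Data.List.Membership.Propositional using (_∈_; lose)
open import Data.List.Relation.Unary.Any using (here; there)
open import Data.List.Relation.Unary.Any.Properties using (any⁺)
open import Data.List.Relation.Unary.All using (lookup)
open import Data.List.Relation.Unary.All.Properties using (all⁺)
open import Data.List.Relation.Binary.Permutation.Propositional using (_↭_; ↭-sym)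
open import Data.List.Relation.Binary.Prefix.Heterogeneous.Properties using (prefix?)
open import Data.List.Relation.Binary.Prefix.Propositional.Properties using (∣ˡ-as-Prefix)
open import Data.Maybe using (Maybe; just; nothing; maybe′)
open import Data.Nat using (ℕ; zero; suc; _≟_)
open import Data.Nat.Properties using (≤-decTotalOrder)
open import Data.List.Sort.InsertionSort.Base ≤-decTotalOrder using (sort)
open import Data.List.Sort.InsertionSort.Properties ≤-decTotalOrder using (sort-↭)
open import Data.Product using (∃-syntax; _×_; _,_)
open import Data.Sum using (_⊎_; inj₁; inj₂)
open import Function using (Equivalence)
open import Relation.Binary.PropositionalEquality using (_≡_; refl; sym; cong; subst)
open import Relation.Nullary using (¬_; yes; no)
open import Relation.Binary.Definitions using (DecidableEquality)
open import Relation.Nullary.Decidable using (isYes; fromWitness; toWitnessFalse)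
open import Algebra.Properties.Monoid.Divisibility (++-monoid ℕ)
  using (_∣ˡ_; ∣ˡ-refl; ∣ˡ-trans; x∣ˡxy)

open Equivalence using (to; from)

_≟ₗ_ : DecidableEquality (List ℕ)
_≟ₗ_ = ≡-dec _≟_

allOps : List Op
allOps = pushL ∷ pushR ∷ popL ∷ popR ∷ []

op∈allOps : (op : Op) → op ∈ allOps
op∈allOps pushL = here refl
op∈allOps pushR = there (here refl)
op∈allOps popL  = there (there (here refl))
op∈allOps popR  = there (there (there (here refl)))

_≼_ : Config → Config → Set
c ≼ c' = out c ∣ˡ out c'

step-≼ : ∀ op {c c'} → step op c ≡ just c' → c ≼ c'
step-≼ pushL {cfg (x ∷ xs) d o} refl = ∣ˡ-refl
step-≼ pushR {cfg (x ∷ xs) d o} refl = ∣ˡ-refl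
step-≼ popL  {cfg i (x ∷ d) o}  refl = x∣ˡxy o (x ∷ [])
step-≼ popR  {cfg i d o} e with reverse d
step-≼ popR  {cfg i d o} refl | x ∷ r = x∣ˡxy o (x ∷ [])

run-∷⁻ : ∀ op ops {c c'} → run (op ∷ ops) c ≡ just c' →
         ∃[ c₁ ] (step op c ≡ just c₁ × run ops c₁ ≡ just c')
run-∷⁻ op ops {c} e with step op c
... | just c₁ = c₁ , refl , e

run-≼ : ∀ ops {c c'} → run ops c ≡ just c' → c ≼ c'
run-≼ []         refl = ∣ˡ-refl
run-≼ (op ∷ ops) r with run-∷⁻ op ops r
... | c₁ , first , rest = ∣ˡ-trans (step-≼ op first) (run-≼ ops rest)

run-∷ : ∀ op ops {c c₁ c'} → step op c ≡ just c₁ → run ops c₁ ≡ just c' →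
        run (op ∷ ops) c ≡ just c'
run-∷ op ops first rest rewrite first = rest

play⇒run : ∀ s π k h {c c'} → play s π k h c ≡ just c' → ∃[ ops ] (run ops c ≡ just c')
play⇒run s π zero    h refl = [] , refl
play⇒run s π (suc k) h {c} e with step (s (revealed π c) h) c in first
... | just c₁ with play⇒run s π k _ e
...   | ops , rest = s (revealed π c) h ∷ ops , run-∷ (s (revealed π c) h) ops first rest

module _ (n : ℕ) where

  sorted? promising? : Config → Bool
  sorted?    c = isYes (out c ≟ₗ oneTo n)
  promising? c = isYes (prefix? _≟_ (out c) (oneTo n))

  -- canComplete f c explores operation sequences from c to depth f, cutting
  -- branches whose output is not a prefix of 1..n and answering true when the
  -- depth is exhausted; so false means c is dead.
  canComplete : ℕ → Config → Bool
  canComplete zero    c = true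
  canComplete (suc f) c = promising? c ∧
    (sorted? c ∨ any (λ op → maybe′ (canComplete f) false (step op c)) allOps)

  canComplete-complete : ∀ f ops {c c'} → run ops c ≡ just c' → out c' ≡ oneTo n →
                         T (canComplete f c)
  canComplete-complete zero    ops r sorted = _
  canComplete-complete (suc f) ops {c} {c'} r sorted =
    from (T-∧ {promising? c}) (promising , from (T-∨ {sorted? c}) (finishedOrExtends ops r))
    where
    promising : T (promising? c)
    promising = fromWitness (∣ˡ-as-Prefix (subst (_ ∣ˡ_) sorted (run-≼ ops r)))

    continues : Op → Bool
    continues op = maybe′ (canComplete f) false (step op c)

    finishedOrExtends : ∀ ops → run ops c ≡ just c' → T (sorted? c) ⊎ T (any continues allOps)
    finishedOrExtends []         refl = inj₁ (fromWitness sorted)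
    finishedOrExtends (op ∷ ops) run-op with run-∷⁻ op ops run-op
    ... | c₁ , first , rest = inj₂ (any⁺ continues (lose (op∈allOps op) (via first)))
      where
      via : ∀ {m} → m ≡ just c₁ → T (maybe′ (canComplete f) false m)
      via refl = canComplete-complete f ops rest sorted

  -- Strategy s, with history h, sorts input π from configuration c.
  -- 'Succeeds n s π' is exactly 'SortsFrom s π [] (start π)'.
  SortsFrom : Strategy → List ℕ → List Op → Config → Set
  SortsFrom s π h c = ∃[ k ] ∃[ c' ] (play s π k h c ≡ just c' × out c' ≡ oneTo n)

  dead : ∀ f s π h c → T (not (canComplete f c)) → ¬ SortsFrom s π h c
  dead f s π h c ¬can (k , c' , p , sorted) with play⇒run s π k h p
  ... | ops , r = impossible (canComplete-complete f ops r sorted) ¬can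
    where
    impossible : ∀ {b} → T b → T (not b) → ⊥
    impossible {false} ()

  firstMove : ∀ {s π h c op} → SortsFrom s π h c → T (not (sorted? c)) →
              s (revealed π c) h ≡ op →
              ∃[ c₁ ] (step op c ≡ just c₁ × SortsFrom s π (h ∷ʳ op) c₁)
  firstMove (zero , c' , refl , sorted) unsorted _ = ⊥-elim (toWitnessFalse unsorted sorted)
  firstMove {s} {π} {h} {c} (suc k , c' , p , sorted) unsorted refl
    with step (s (revealed π c) h) c
  ... | just c₁ = c₁ , refl , k , c' , p , sorted

  module _ (π₁ π₂ : List ℕ) (searchDepth : ℕ) where

    -- Apply a test to the results of the same operation in both games; an
    -- operation impossible in both games defeats the strategy in both.
    both : (Config → Config → Bool) → Maybe Config → Maybe Config → Bool
    both R (just c₁) (just c₂) = R c₁ c₂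
    both R nothing   nothing   = true
    both R _         _         = false

    both-sound : ∀ {R m₁ m₂ c₁ c₂} → T (both R m₁ m₂) → m₁ ≡ just c₁ → m₂ ≡ just c₂ → T (R c₁ c₂)
    both-sound t refl refl = t

    refuted : ℕ → Config → Config → Bool
    refuted zero    c₁ c₂ = false
    refuted (suc f) c₁ c₂ =
      if isYes (revealed π₁ c₁ ≟ₗ revealed π₂ c₂)
      then not (sorted? c₁) ∧ (not (sorted? c₂) ∧
             all (λ op → both (refuted f) (step op c₁) (step op c₂)) allOps)
      else not (canComplete searchDepth c₁) ∨ not (canComplete searchDepth c₂)

    NoCommonWin : Config → Config → Set
    NoCommonWin c₁ c₂ = ∀ s h → ¬ (SortsFrom s π₁ h c₁ × SortsFrom s π₂ h c₂)

    refuted-sound : ∀ f c₁ c₂ → T (refuted f c₁ c₂) → NoCommonWin c₁ c₂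
    refuted-sound zero    c₁ c₂ ()
    refuted-sound (suc f) c₁ c₂ t s h (w₁ , w₂)
      with revealed π₁ c₁ ≟ₗ revealed π₂ c₂
    ... | no _ with to (T-∨ {not (canComplete searchDepth c₁)}) t
    ...   | inj₁ dead₁ = dead searchDepth s π₁ h c₁ dead₁ w₁
    ...   | inj₂ dead₂ = dead searchDepth s π₂ h c₂ dead₂ w₂
    -- same view: the strategy makes the same move in both games
    refuted-sound (suc f) c₁ c₂ t s h (w₁ , w₂) | yes sameView
      with to (T-∧ {not (sorted? c₁)}) t
    ... | unsorted₁ , rest with to (T-∧ {not (sorted? c₂)}) rest
    ...   | unsorted₂ , everyOp
      with firstMove w₁ unsorted₁ refl | firstMove w₂ unsorted₂ (cong (λ view → s view h) (sym sameView))
    ... | a , stepA , wA | b , stepB , wB =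
      refuted-sound f a b (both-sound (lookup (all⁺ jointly allOps everyOp) (op∈allOps op)) stepA stepB)
                    s (h ∷ʳ op) (wA , wB)
      where
      op : Op
      op = s (revealed π₁ c₁) h
      jointly : Op → Bool
      jointly op = both (refuted f) (step op c₁) (step op c₂)

π₁ π₂ : List ℕ
π₁ = 5 ∷ 6 ∷ 2 ∷ 4 ∷ 1 ∷ 7 ∷ 3 ∷ []
π₂ = 5 ∷ 6 ∷ 2 ∷ 7 ∷ 1 ∷ 3 ∷ 4 ∷ []

sorts-to-oneTo : ∀ π → sort π ≡ oneTo 7 → π ↭ oneTo 7
sorts-to-oneTo π e = subst (π ↭_) e (↭-sym (sort-↭ π))

π₁-sortable : DequeSortable 7 π₁
π₁-sortable =
  pushL ∷ pushL ∷ pushL ∷ pushR ∷ pushL ∷ popL ∷ popL ∷ pushL ∷ pushL ∷ popL ∷ popR ∷ popR ∷ popR ∷ popL ∷ []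
  , _ , refl , refl

π₂-sortable : DequeSortable 7 π₂
π₂-sortable =
  pushL ∷ pushL ∷ pushR ∷ pushL ∷ pushL ∷ popL ∷ pushL ∷ popR ∷ pushR ∷ popL ∷ popR ∷ popR ∷ popR ∷ popL ∷ []
  , _ , refl , refl

π₁π₂-refuted : T (refuted 7 π₁ π₂ 16 10 (start π₁) (start π₂))
π₁π₂-refuted = _

theorem10p1 : ∃[ π₁ ] ∃[ π₂ ]
    ((π₁ ↭ oneTo 7) × (π₂ ↭ oneTo 7)
    × DequeSortable 7 π₁ × DequeSortable 7 π₂
    × ((s : Strategy) → ¬ (Succeeds 7 s π₁ × Succeeds 7 s π₂)))
theorem10p1 =
  π₁ , π₂ , sorts-to-oneTo π₁ refl , sorts-to-oneTo π₂ refl , π₁-sortable , π₂-sortable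
  , λ s → refuted-sound 7 π₁ π₂ 16 10 (start π₁) (start π₂) π₁π₂-refuted s []
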